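{- Let $q$ be a prime power, $F$ a non-archimedean local field with residue field of order $q$, and $X$ a non-partite Ramanujan quotient of the Bruhat–Tits building $\tilde A_3(F)$ (so every triangle of $X$ lies in exactly $q+1$ three-cells). For every $\beta\in C^2(X,\mathbb{F}_2)$, $$|\delta_2\beta|=\frac14\sum_{v\in X(0)}|\delta_1\beta_v^1+\beta_v^2|\ \ge\ \frac14\Big(\sum_{v\in X(0)}|\delta_1\beta_v^1|-\sum_{v\in X(0)}|\beta_v^2|\Big)=\frac14\sum_{v\in X(0)}|\delta_1\beta_v^1|-\frac{q+1}{4}|\beta|.$$
   Context: $C^i(Y,\mathbb{F}_2)$ is the space of functions on $i$-cells of a complex $Y$, identified with subsets, and $|\cdot|$ is cardinality; $\delta_i(\alpha)(\sigma)=\sum_{\tau\subset\sigma,\dim\tau=i}\alpha(\tau)$. For a vertex $v$, the link $X_v=\{\tau: v\notin\tau,\ \tau\cup\{v\}\in X\}$ is a $2$-dimensional complex, and $\delta_1$ in $\delta_1\beta_v^1$ is the coboundary of $X_v$. For $\beta\in C^2(X,\mathbb{F}_2)$: $\beta_v^1\in C^1(X_v,\mathbb{F}_2)$ is defined by $\beta_v^1(e)=\beta(e\cup\{v\})$ for edges $e$ of $X_v$, and $\beta_v^2\in C^2(X_v,\mathbb{F}_2)$ is the restriction of $\beta$ to the triangles of $X_v$ (triangles $\tau$ of $X$ with $v\notin\tau$, $\tau\cup\{v\}\in X$). Building and Ramanujan quotient: $\tilde A_3(F)$ has vertices the homothety classes of $\mathcal{O}$-lattices in $F^4$ ($\mathcal{O}$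 the valuation ring, $\pi$ a uniformizer), with $[L_0],\dots,[L_i]$ an $i$-cell iff representatives satisfy $\pi L_0'\subsetneq L_i'\subsetneq\cdots\subsetneq L_0'$; $X=\Gamma\backslash\tilde A_3(F)$ with $\Gamma\le PGL_4(F)$ cocompact discrete, $\mathrm{dist}(\gamma x,x)>2$ for all vertices $x$, $1\ne\gamma\in\Gamma$, $\Gamma\cdot PSL_4(F)PGL_4(\mathcal{O})=PGL_4(F)$ (non-partite), and the nontrivial joint spectrum of the color Hecke operators on $X(0)$ contained in that of the building (Ramanujan). -}

module Defs where

open import Data.Nat using (ℕ; zero; suc; _+_; _*_; _^_; _≤_; _≡ᵇ_)
open import Data.Nat.Primality using (Prime)
open import Data.Bool using (Bool; true; false; _∧_; not; _xor_; if_then_else_)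
open import Data.Fin using (Fin)
open import Data.Fin.Subset using (Subset; ⁅_⁆; _∪_; _-_; _∈_; _⊆_; ∣_∣)
open import Data.Vec using (Vec; []; _∷_; lookup)
open import Data.List using (List; []; _∷_; map; _++_; filterᵇ; length; foldr; allFin)
open import Data.Nat.ListAction using (sum)
open import Data.Product using (Σ; _×_)
open import Relation.Binary.PropositionalEquality using (_≡_)

IsPrimePower : ℕ → Set
IsPrimePower q = Σ ℕ λ p → Σ ℕ λ k → Prime p × 1 ≤ k × q ≡ p ^ k

allSubsets : (n : ℕ) → List (Subset n)
allSubsets zero = [] ∷ []
allSubsets (suc n) = map (false ∷_) (allSubsets n) ++ map (true ∷_) (allSubsets n)

_⊆ᵇ_ : ∀ {n} → Subset n → Subset n → Bool
[] ⊆ᵇ [] = true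
(false ∷ s) ⊆ᵇ (_ ∷ t) = s ⊆ᵇ t
(true ∷ s) ⊆ᵇ (b ∷ t) = b ∧ (s ⊆ᵇ t)

elems : ∀ {n} → Subset n → List (Fin n)
elems {n} s = filterᵇ (λ x → lookup s x) (allFin n)

-- A finite simplicial complex on the vertex set Fin n (vertex set X(0) = Fin n)
-- is given by a boolean face predicate; its i-cells are faces with i+1 vertices.
Faces : ℕ → Set
Faces n = Subset n → Bool

record IsComplex {n : ℕ} (face : Faces n) : Set where
  field
    downClosed : ∀ s t → s ⊆ t → face t ≡ true → face s ≡ true
    vertices   : ∀ v → face ⁅ v ⁆ ≡ true

Dim≤3 : ∀ {n} → Faces n → Set
Dim≤3 face = ∀ s → face s ≡ true → ∣ s ∣ ≤ 4

cells : ∀ {n} → Faces n → ℕ → List (Subset n)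
cells {n} face i = filterᵇ (λ s → face s ∧ (∣ s ∣ ≡ᵇ suc i)) (allSubsets n)

TrianglesIn : ∀ {n} → Faces n → ℕ → Set
TrianglesIn face m = ∀ τ → face τ ≡ true → ∣ τ ∣ ≡ 3 →
  length (filterᵇ (λ σ → τ ⊆ᵇ σ) (cells face 3)) ≡ m

-- F₂-cochains: functions on subsets (only values on i-cells matter)
Cochain : ℕ → Set
Cochain n = Subset n → Bool

norm : ∀ {n} → Faces n → ℕ → Cochain n → ℕ
norm face i α = length (filterᵇ α (cells face i))

cobd : ∀ {n} → Cochain n → Cochain n
cobd α σ = foldr (λ x b → α (σ - x) xor b) false (elems σ)

_⊕_ : ∀ {n} → Cochain n → Cochain n → Cochain n
(α ⊕ β) s = α s xor β s

link : ∀ {n} → Faces n → Fin n → Faces n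
link face v τ = not (lookup τ v) ∧ face (τ ∪ ⁅ v ⁆)

beta1 : ∀ {n} → Cochain n → Fin n → Cochain n
beta1 β v e = β (e ∪ ⁅ v ⁆)

-- β_v^2 = restriction of β to triangles of X_v (restriction is implicit,
-- since norms on X_v only count 2-cells of X_v)
beta2 : ∀ {n} → Cochain n → Fin n → Cochain n
beta2 β v = β

sumV : ∀ {n} → (Fin n → ℕ) → ℕ
sumV {n} f = sum (map f (allFin n))

module Submission where

-- Everything reduces to counting with indicators.  A norm |α| is a sum of
-- indicators over all subsets, and sums over vertices and subsets commute.
--  * Link decomposition: for v ∈ σ,  δ(β_v¹)(σ∖v) + β(σ∖v) = δβ(σ), because
--    δβ(σ) = ⊕_{x∈σ} β(σ∖x) splits into the term x = v and the terms x ≠ v,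
--    where σ∖x = ((σ∖v)∖x) ∪ {v}.  As τ ↦ τ ∪ {v} matches the i-cells of X_v
--    with the (i+1)-cells of X through v, summing over v counts each
--    (i+1)-cell σ with δβ(σ) = 1 once per vertex, i.e. i+2 times.
--  * Regularity: an i-cell τ lies in the links of exactly those v with
--    τ ∪ {v} ∈ X; if every i-cell has m cofaces, Σ_v |α|_{X_v} = m |α|_X.
--  * The inequality is the triangle inequality |a| ≤ |a+b| + |b| in each link.

open import Defs
open import Data.Nat using (ℕ; suc; _*_)
open import Data.Integer using (_≤_; _-_; +_)
open import Data.Product using (_×_)
open import Relation.Binary.PropositionalEquality using (_≡_)

open import Data.Nat using (zero; _+_; _∸_; _≡ᵇ_; z≤n; s≤s)
import Data.Nat as ℕ
import Data.Nat.Properties as ℕₚ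
open import Data.Integer using (_⊖_)
import Data.Integer.Properties as ℤₚ
open import Data.Bool using (Bool; true; false; _∧_; _xor_; if_then_else_; T)
open import Data.Bool.Properties using (∧-zeroʳ; ∧-identityʳ; ∨-identityʳ; xor-comm)
open import Data.Fin using (Fin)
open import Data.Fin.Subset using (Subset; ⁅_⁆; _∪_; ∣_∣; ⊥; _─_) renaming (_-_ to _⊝_)
open import Data.Fin.Subset.Properties using (p─⊥≡p; ∪-identityʳ; p⊆p∪q)
open import Data.Vec using ([]; _∷_; lookup)
open import Data.List using (List; []; _∷_; map; _++_; filterᵇ; length; foldr; allFin)
open import Data.List.Properties using (map-cong; map-++; map-∘; map-tabulate; foldr-map)
open import Data.Nat.ListAction using (sum)
open import Data.Nat.ListAction.Properties using (sum-++)
open import Data.Product using (_,_)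
open import Data.Empty using (⊥-elim)
open import Function using (_∘_; id)
open import Relation.Binary.PropositionalEquality using (refl; sym; trans; cong; cong₂; subst; module ≡-Reasoning)
open import Algebra.Properties.CommutativeSemigroup ℕₚ.+-commutativeSemigroup
  using () renaming (interchange to +-interchange)

sumOver : {A : Set} → List A → (A → ℕ) → ℕ
sumOver xs f = sum (map f xs)

xorOver : {A : Set} → List A → (A → Bool) → Bool
xorOver xs g = foldr (λ x b → g x xor b) false xs

sumOver-cong : ∀ {A : Set} (xs : List A) {f g : A → ℕ} →
  (∀ x → f x ≡ g x) → sumOver xs f ≡ sumOver xs g
sumOver-cong xs f≗g = cong sum (map-cong f≗g xs)

sumOver-++ : ∀ {A : Set} (xs ys : List A) (f : A → ℕ) →
  sumOver (xs ++ ys) f ≡ sumOver xs f + sumOver ys f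
sumOver-++ xs ys f = trans (cong sum (map-++ f xs ys)) (sum-++ (map f xs) (map f ys))

sumOver-map : ∀ {A B : Set} (xs : List A) (g : A → B) (f : B → ℕ) →
  sumOver (map g xs) f ≡ sumOver xs (f ∘ g)
sumOver-map xs g f = cong sum (sym (map-∘ xs))

sumOver-vanishes : ∀ {A : Set} (xs : List A) {f : A → ℕ} → (∀ x → f x ≡ 0) → sumOver xs f ≡ 0
sumOver-vanishes [] _ = refl
sumOver-vanishes (x ∷ xs) f≡0 = cong₂ _+_ (f≡0 x) (sumOver-vanishes xs f≡0)

sumOver-+ : ∀ {A : Set} (xs : List A) (f g : A → ℕ) →
  sumOver xs (λ x → f x + g x) ≡ sumOver xs f + sumOver xs g
sumOver-+ [] f g = refl
sumOver-+ (x ∷ xs) f g =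
  trans (cong (_+_ (f x + g x)) (sumOver-+ xs f g)) (+-interchange (f x) (g x) _ _)

sumOver-*ˡ : ∀ {A : Set} (xs : List A) (c : ℕ) (f : A → ℕ) →
  sumOver xs (λ x → c * f x) ≡ c * sumOver xs f
sumOver-*ˡ [] c f = sym (ℕₚ.*-zeroʳ c)
sumOver-*ˡ (x ∷ xs) c f =
  trans (cong (_+_ (c * f x)) (sumOver-*ˡ xs c f)) (sym (ℕₚ.*-distribˡ-+ c (f x) _))

sumOver-*ʳ : ∀ {A : Set} (xs : List A) (c : ℕ) (f : A → ℕ) →
  sumOver xs (λ x → f x * c) ≡ sumOver xs f * c
sumOver-*ʳ [] c f = refl
sumOver-*ʳ (x ∷ xs) c f =
  trans (cong (_+_ (f x * c)) (sumOver-*ʳ xs c f)) (sym (ℕₚ.*-distribʳ-+ c (f x) _))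

sumOver-swap : ∀ {A B : Set} (xs : List A) (ys : List B) (f : A → B → ℕ) →
  sumOver xs (λ x → sumOver ys (f x)) ≡ sumOver ys (λ y → sumOver xs (λ x → f x y))
sumOver-swap [] ys f = sym (sumOver-vanishes ys (λ _ → refl))
sumOver-swap (x ∷ xs) ys f =
  trans (cong (_+_ (sumOver ys (f x))) (sumOver-swap xs ys f))
        (sym (sumOver-+ ys (f x) (λ y → sumOver xs (λ x′ → f x′ y))))

sumOver-mono : ∀ {A : Set} (xs : List A) {f g : A → ℕ} →
  (∀ x → f x ℕ.≤ g x) → sumOver xs f ℕ.≤ sumOver xs g
sumOver-mono [] _ = z≤n
sumOver-mono (x ∷ xs) f≤g = ℕₚ.+-mono-≤ (f≤g x) (sumOver-mono xs f≤g)

xorOver-cong : ∀ {A : Set} (xs : List A) {f g : A → Bool} →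
  (∀ x → f x ≡ g x) → xorOver xs f ≡ xorOver xs g
xorOver-cong [] _ = refl
xorOver-cong (x ∷ xs) f≗g = cong₂ _xor_ (f≗g x) (xorOver-cong xs f≗g)

xorOver-filter : ∀ {A : Set} (xs : List A) (p g : A → Bool) →
  xorOver (filterᵇ p xs) g ≡ xorOver xs (λ x → p x ∧ g x)
xorOver-filter [] p g = refl
xorOver-filter (x ∷ xs) p g with p x
... | true = cong (g x xor_) (xorOver-filter xs p g)
... | false = xorOver-filter xs p g

allFin-suc : ∀ n → allFin (suc n) ≡ Fin.zero ∷ map Fin.suc (allFin n)
allFin-suc n = cong (Fin.zero ∷_) (sym (map-tabulate id Fin.suc))

sumOver-allFin-suc : ∀ n (f : Fin (suc n) → ℕ) →
  sumOver (allFin (suc n)) f ≡ f Fin.zero + sumOver (allFin n) (f ∘ Fin.suc)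
sumOver-allFin-suc n f =
  trans (cong (λ xs → sumOver xs f) (allFin-suc n))
        (cong (_+_ (f Fin.zero)) (sumOver-map (allFin n) Fin.suc f))

xorOver-allFin-suc : ∀ n (g : Fin (suc n) → Bool) →
  xorOver (allFin (suc n)) g ≡ g Fin.zero xor xorOver (allFin n) (g ∘ Fin.suc)
xorOver-allFin-suc n g =
  trans (cong (λ xs → xorOver xs g) (allFin-suc n))
        (cong (g Fin.zero xor_) (foldr-map (λ x b → g x xor b) Fin.suc false (allFin n)))

sumOver-allSubsets-suc : ∀ n (f : Subset (suc n) → ℕ) →
  sumOver (allSubsets (suc n)) f
    ≡ sumOver (allSubsets n) (λ s → f (false ∷ s)) + sumOver (allSubsets n) (λ s → f (true ∷ s))
sumOver-allSubsets-suc n f =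
  trans (sumOver-++ (map (false ∷_) (allSubsets n)) _ f)
        (cong₂ _+_ (sumOver-map (allSubsets n) (false ∷_) f) (sumOver-map (allSubsets n) (true ∷_) f))

⟦_⟧ : Bool → ℕ
⟦ true ⟧ = 1
⟦ false ⟧ = 0

⟦∧⟧-factor : ∀ a b c → ⟦ (a ∧ b) ∧ c ⟧ ≡ ⟦ a ⟧ * ⟦ b ∧ c ⟧
⟦∧⟧-factor true b c = sym (ℕₚ.+-identityʳ ⟦ b ∧ c ⟧)
⟦∧⟧-factor false b c = refl

⟦⟧-triangle : ∀ c a b → ⟦ c ∧ a ⟧ ℕ.≤ ⟦ c ∧ (a xor b) ⟧ + ⟦ c ∧ b ⟧
⟦⟧-triangle false a b = z≤n
⟦⟧-triangle true true true = s≤s z≤n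
⟦⟧-triangle true true false = s≤s z≤n
⟦⟧-triangle true false b = z≤n

remove-add : ∀ {n} (σ : Subset n) v → lookup σ v ≡ true → (σ ⊝ v) ∪ ⁅ v ⁆ ≡ σ
remove-add (true ∷ σ) Fin.zero _ = cong (true ∷_) (trans (∪-identityʳ (σ ─ ⊥)) (p─⊥≡p σ))
remove-add (b ∷ σ) (Fin.suc v) v∈σ = cong₂ _∷_ (∨-identityʳ b) (remove-add σ v v∈σ)

size-remove : ∀ {n} (σ : Subset n) v → lookup σ v ≡ true → ∣ σ ∣ ≡ suc ∣ σ ⊝ v ∣
size-remove (true ∷ σ) Fin.zero _ = cong (suc ∘ ∣_∣) (sym (p─⊥≡p σ))
size-remove (true ∷ σ) (Fin.suc v) v∈σ = cong suc (size-remove σ v v∈σ)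
size-remove (false ∷ σ) (Fin.suc v) v∈σ = size-remove σ v v∈σ

remove-remove-add : ∀ {n} (σ : Subset n) v x → lookup σ v ≡ true → lookup (σ ⊝ v) x ≡ true →
  ((σ ⊝ v) ⊝ x) ∪ ⁅ v ⁆ ≡ σ ⊝ x
remove-remove-add (true ∷ σ) Fin.zero (Fin.suc x) _ _ =
  cong (true ∷_) (trans (∪-identityʳ _) (cong (_⊝ x) (p─⊥≡p σ)))
remove-remove-add (true ∷ σ) (Fin.suc v) Fin.zero v∈σ _ =
  cong (false ∷_) (trans (cong (_∪ ⁅ v ⁆) (p─⊥≡p (σ ⊝ v))) (trans (remove-add σ v v∈σ) (sym (p─⊥≡p σ))))
remove-remove-add (b ∷ σ) (Fin.suc v) (Fin.suc x) v∈σ x∈σ∖v =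
  cong₂ _∷_ (∨-identityʳ b) (remove-remove-add σ v x v∈σ x∈σ∖v)

xorIn : ∀ {n} → Subset n → (Fin n → Bool) → Bool
xorIn {n} σ g = xorOver (allFin n) (λ x → lookup σ x ∧ g x)

cobd-as-xorIn : ∀ {n} (α : Cochain n) σ → cobd α σ ≡ xorIn σ (λ x → α (σ ⊝ x))
cobd-as-xorIn {n} α σ = xorOver-filter (allFin n) (lookup σ) (λ x → α (σ ⊝ x))

xorIn-cong : ∀ {n} (σ : Subset n) {g h : Fin n → Bool} →
  (∀ x → lookup σ x ≡ true → g x ≡ h x) → xorIn σ g ≡ xorIn σ h
xorIn-cong {n} σ {g} {h} g≗h = xorOver-cong (allFin n) masked
  where
  masked : ∀ x → (lookup σ x ∧ g x) ≡ (lookup σ x ∧ h x)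
  masked x with lookup σ x in x∈σ
  ... | true = g≗h x x∈σ
  ... | false = refl

xorIn-suc : ∀ {n} b (σ : Subset n) (g : Fin (suc n) → Bool) →
  xorIn (b ∷ σ) g ≡ (b ∧ g Fin.zero) xor xorIn σ (g ∘ Fin.suc)
xorIn-suc {n} b σ g = xorOver-allFin-suc n (λ x → lookup (b ∷ σ) x ∧ g x)

xor-swapˡ : ∀ a b c → a xor (b xor c) ≡ b xor (a xor c)
xor-swapˡ true true c = refl
xor-swapˡ true false c = refl
xor-swapˡ false b c = refl

xorIn-remove : ∀ {n} (σ : Subset n) v (g : Fin n → Bool) → lookup σ v ≡ true →
  xorIn σ g ≡ g v xor xorIn (σ ⊝ v) g
xorIn-remove (true ∷ σ) Fin.zero g _ = begin
  xorIn (true ∷ σ) g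
    ≡⟨ xorIn-suc true σ g ⟩
  g Fin.zero xor xorIn σ (g ∘ Fin.suc)
    ≡⟨ cong (λ ρ → g Fin.zero xor xorIn ρ (g ∘ Fin.suc)) (sym (p─⊥≡p σ)) ⟩
  g Fin.zero xor xorIn (σ ─ ⊥) (g ∘ Fin.suc)
    ≡⟨ cong (g Fin.zero xor_) (sym (xorIn-suc false (σ ─ ⊥) g)) ⟩
  g Fin.zero xor xorIn (false ∷ (σ ─ ⊥)) g ∎
  where open ≡-Reasoning
xorIn-remove (b ∷ σ) (Fin.suc v) g v∈σ = begin
  xorIn (b ∷ σ) g
    ≡⟨ xorIn-suc b σ g ⟩
  (b ∧ g Fin.zero) xor xorIn σ (g ∘ Fin.suc)
    ≡⟨ cong ((b ∧ g Fin.zero) xor_) (xorIn-remove σ v (g ∘ Fin.suc) v∈σ) ⟩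
  (b ∧ g Fin.zero) xor (g (Fin.suc v) xor xorIn (σ ⊝ v) (g ∘ Fin.suc))
    ≡⟨ xor-swapˡ (b ∧ g Fin.zero) (g (Fin.suc v)) _ ⟩
  g (Fin.suc v) xor ((b ∧ g Fin.zero) xor xorIn (σ ⊝ v) (g ∘ Fin.suc))
    ≡⟨ cong (g (Fin.suc v) xor_) (sym (xorIn-suc b (σ ⊝ v) g)) ⟩
  g (Fin.suc v) xor xorIn (b ∷ (σ ⊝ v)) g ∎
  where open ≡-Reasoning

cobd-link : ∀ {n} (β : Cochain n) σ v → lookup σ v ≡ true →
  cobd (beta1 β v) (σ ⊝ v) xor β (σ ⊝ v) ≡ cobd β σ
cobd-link β σ v v∈σ = begin
  cobd (beta1 β v) (σ ⊝ v) xor β (σ ⊝ v)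
    ≡⟨ cong (_xor β (σ ⊝ v)) (cobd-as-xorIn (beta1 β v) (σ ⊝ v)) ⟩
  xorIn (σ ⊝ v) (λ x → β (((σ ⊝ v) ⊝ x) ∪ ⁅ v ⁆)) xor β (σ ⊝ v)
    ≡⟨ cong (_xor β (σ ⊝ v))
         (xorIn-cong (σ ⊝ v) (λ x x∈σ∖v → cong β (remove-remove-add σ v x v∈σ x∈σ∖v))) ⟩
  xorIn (σ ⊝ v) (λ x → β (σ ⊝ x)) xor β (σ ⊝ v)
    ≡⟨ xor-comm _ (β (σ ⊝ v)) ⟩
  β (σ ⊝ v) xor xorIn (σ ⊝ v) (λ x → β (σ ⊝ x))
    ≡⟨ sym (xorIn-remove σ v (λ x → β (σ ⊝ x)) v∈σ) ⟩
  xorIn σ (λ x → β (σ ⊝ x))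
    ≡⟨ sym (cobd-as-xorIn β σ) ⟩
  cobd β σ ∎
  where open ≡-Reasoning

isCell : ∀ {n} → Faces n → ℕ → Subset n → Bool
isCell X i s = X s ∧ (∣ s ∣ ≡ᵇ suc i)

length-filter-filter : ∀ {A : Set} (xs : List A) (p α : A → Bool) →
  length (filterᵇ α (filterᵇ p xs)) ≡ sumOver xs (λ s → ⟦ p s ∧ α s ⟧)
length-filter-filter [] p α = refl
length-filter-filter (x ∷ xs) p α with p x
... | false = length-filter-filter xs p α
... | true with α x
...   | true = cong suc (length-filter-filter xs p α)
...   | false = length-filter-filter xs p α

norm-as-sum : ∀ {n} (X : Faces n) i (α : Cochain n) →
  norm X i α ≡ sumOver (allSubsets n) (λ s → ⟦ isCell X i s ∧ α s ⟧)
norm-as-sum {n} X i α = length-filter-filter (allSubsets n) (isCell X i) α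

≡ᵇ-true : ∀ a b → (a ≡ᵇ b) ≡ true → a ≡ b
≡ᵇ-true a b eq = ℕₚ.≡ᵇ⇒≡ a b (subst T (sym eq) _)

norm-triangle : ∀ {n} (X : Faces n) i (α β : Cochain n) →
  norm X i α ℕ.≤ norm X i (α ⊕ β) + norm X i β
norm-triangle {n} X i α β = begin
  norm X i α
    ≡⟨ norm-as-sum X i α ⟩
  sumOver (allSubsets n) (λ s → ⟦ isCell X i s ∧ α s ⟧)
    ≤⟨ sumOver-mono (allSubsets n) (λ s → ⟦⟧-triangle (isCell X i s) (α s) (β s)) ⟩
  sumOver (allSubsets n) (λ s → ⟦ isCell X i s ∧ (α ⊕ β) s ⟧ + ⟦ isCell X i s ∧ β s ⟧)
    ≡⟨ sumOver-+ (allSubsets n) _ _ ⟩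
  sumOver (allSubsets n) (λ s → ⟦ isCell X i s ∧ (α ⊕ β) s ⟧)
    + sumOver (allSubsets n) (λ s → ⟦ isCell X i s ∧ β s ⟧)
    ≡⟨ sym (cong₂ _+_ (norm-as-sum X i (α ⊕ β)) (norm-as-sum X i β)) ⟩
  norm X i (α ⊕ β) + norm X i β ∎
  where open ℕₚ.≤-Reasoning

sub-≤ : ∀ a b c → a ℕ.≤ c + b → + a - + b ≤ + c
sub-≤ a b c a≤c+b = begin
  + a - + b       ≡⟨ ℤₚ.[+m]-[+n]≡m⊖n a b ⟩
  a ⊖ b           ≤⟨ ℤₚ.⊖-monoˡ-≤ b a≤c+b ⟩
  (c + b) ⊖ b     ≡⟨ ℤₚ.⊖-≥ (ℕₚ.m≤n+m b c) ⟩
  + (c + b ∸ b)   ≡⟨ cong +_ (ℕₚ.m+n∸n≡m c b) ⟩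
  + c ∎
  where open ℤₚ.≤-Reasoning

sumV-norm-triangle : ∀ {n} (F : Fin n → Faces n) i (α β : Fin n → Cochain n) →
  + sumV (λ v → norm (F v) i (α v)) - + sumV (λ v → norm (F v) i (β v))
    ≤ + sumV (λ v → norm (F v) i (α v ⊕ β v))
sumV-norm-triangle {n} F i α β = sub-≤ _ _ _ (begin
  sumV (λ v → norm (F v) i (α v))
    ≤⟨ sumOver-mono (allFin n) (λ v → norm-triangle (F v) i (α v) (β v)) ⟩
  sumOver (allFin n) (λ v → norm (F v) i (α v ⊕ β v) + norm (F v) i (β v))
    ≡⟨ sumOver-+ (allFin n) _ _ ⟩
  sumV (λ v → norm (F v) i (α v ⊕ β v)) + sumV (λ v → norm (F v) i (β v)) ∎)
  where open ℕₚ.≤-Reasoning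

-- τ ↦ τ ∪ {v} matches the subsets avoiding v with those containing v
-- (inverse σ ↦ σ∖v); as a reindexing of sums over all subsets:
sum-avoiding≡sum-containing : ∀ {n} v (k : Subset n → ℕ) →
  sumOver (allSubsets n) (λ τ → if lookup τ v then 0 else k τ)
    ≡ sumOver (allSubsets n) (λ σ → if lookup σ v then k (σ ⊝ v) else 0)
sum-avoiding≡sum-containing {suc n} Fin.zero k = begin
  sumOver (allSubsets (suc n)) (λ τ → if lookup τ Fin.zero then 0 else k τ)
    ≡⟨ sumOver-allSubsets-suc n _ ⟩
  sumOver (allSubsets n) (λ s → k (false ∷ s)) + sumOver (allSubsets n) (λ _ → 0)
    ≡⟨ ℕₚ.+-comm _ (sumOver (allSubsets n) (λ _ → 0)) ⟩
  sumOver (allSubsets n) (λ _ → 0) + sumOver (allSubsets n) (λ s → k (false ∷ s))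
    ≡⟨ cong (_+_ (sumOver (allSubsets n) (λ _ → 0)))
         (sumOver-cong (allSubsets n) (λ s → cong (k ∘ (false ∷_)) (sym (p─⊥≡p s)))) ⟩
  sumOver (allSubsets n) (λ _ → 0) + sumOver (allSubsets n) (λ s → k (false ∷ (s ─ ⊥)))
    ≡⟨ sym (sumOver-allSubsets-suc n _) ⟩
  sumOver (allSubsets (suc n)) (λ σ → if lookup σ Fin.zero then k (σ ⊝ Fin.zero) else 0) ∎
  where open ≡-Reasoning
sum-avoiding≡sum-containing {suc n} (Fin.suc v) k =
  trans (sumOver-allSubsets-suc n _)
    (trans (cong₂ _+_ (sum-avoiding≡sum-containing v (k ∘ (false ∷_)))
                      (sum-avoiding≡sum-containing v (k ∘ (true ∷_))))
           (sym (sumOver-allSubsets-suc n _)))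

sum-members : ∀ {n} (σ : Subset n) c →
  sumOver (allFin n) (λ v → if lookup σ v then c else 0) ≡ ∣ σ ∣ * c
sum-members [] c = refl
sum-members {suc n} (true ∷ σ) c =
  trans (sumOver-allFin-suc n (λ v → if lookup (true ∷ σ) v then c else 0)) (cong (_+_ c) (sum-members σ c))
sum-members {suc n} (false ∷ σ) c =
  trans (sumOver-allFin-suc n (λ v → if lookup (false ∷ σ) v then c else 0)) (sum-members σ c)

size-on-cell : ∀ {n} (X : Faces n) j (σ : Subset n) b →
  ∣ σ ∣ * ⟦ isCell X j σ ∧ b ⟧ ≡ suc j * ⟦ isCell X j σ ∧ b ⟧
size-on-cell X j σ b with X σ | ∣ σ ∣ ≡ᵇ suc j in size
... | false | _ = trans (ℕₚ.*-zeroʳ ∣ σ ∣) (sym (ℕₚ.*-zeroʳ (suc j)))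
... | true | false = trans (ℕₚ.*-zeroʳ ∣ σ ∣) (sym (ℕₚ.*-zeroʳ (suc j)))
... | true | true = cong (_* ⟦ b ⟧) (≡ᵇ-true ∣ σ ∣ (suc j) size)

link-norm-cobd : ∀ {n} (X : Faces n) i (β : Cochain n) v →
  norm (link X v) i (cobd (beta1 β v) ⊕ beta2 β v)
    ≡ sumOver (allSubsets n)
        (λ σ → if lookup σ v then ⟦ isCell X (suc i) σ ∧ cobd β σ ⟧ else 0)
link-norm-cobd {n} X i β v = begin
  norm (link X v) i γ
    ≡⟨ norm-as-sum (link X v) i γ ⟩
  sumOver (allSubsets n) (λ τ → ⟦ isCell (link X v) i τ ∧ γ τ ⟧)
    ≡⟨ sumOver-cong (allSubsets n) link-cell ⟩
  sumOver (allSubsets n) (λ τ → if lookup τ v then 0 else k τ)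
    ≡⟨ sum-avoiding≡sum-containing v k ⟩
  sumOver (allSubsets n) (λ σ → if lookup σ v then k (σ ⊝ v) else 0)
    ≡⟨ sumOver-cong (allSubsets n) cone-cell ⟩
  sumOver (allSubsets n) (λ σ → if lookup σ v then ⟦ isCell X (suc i) σ ∧ cobd β σ ⟧ else 0) ∎
  where
  open ≡-Reasoning
  γ : Cochain n
  γ = cobd (beta1 β v) ⊕ beta2 β v
  k : Subset n → ℕ
  k τ = ⟦ (X (τ ∪ ⁅ v ⁆) ∧ (∣ τ ∣ ≡ᵇ suc i)) ∧ γ τ ⟧
  link-cell : ∀ τ → ⟦ isCell (link X v) i τ ∧ γ τ ⟧ ≡ (if lookup τ v then 0 else k τ)
  link-cell τ with lookup τ v
  ... | true = refl
  ... | false = refl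
  cone-cell : ∀ σ → (if lookup σ v then k (σ ⊝ v) else 0)
                  ≡ (if lookup σ v then ⟦ isCell X (suc i) σ ∧ cobd β σ ⟧ else 0)
  cone-cell σ with lookup σ v in v∈σ
  ... | false = refl
  ... | true = cong₂ (λ c b → ⟦ c ∧ b ⟧)
    (cong₂ _∧_ (cong X (remove-add σ v v∈σ)) (cong (_≡ᵇ suc (suc i)) (sym (size-remove σ v v∈σ))))
    (cobd-link β σ v v∈σ)

sumV-link-norm-cobd : ∀ {n} (X : Faces n) i (β : Cochain n) →
  sumV (λ v → norm (link X v) i (cobd (beta1 β v) ⊕ beta2 β v))
    ≡ suc (suc i) * norm X (suc i) (cobd β)
sumV-link-norm-cobd {n} X i β = begin
  sumV (λ v → norm (link X v) i (cobd (beta1 β v) ⊕ beta2 β v))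
    ≡⟨ sumOver-cong (allFin n) (link-norm-cobd X i β) ⟩
  sumOver (allFin n) (λ v → sumOver (allSubsets n) (λ σ → if lookup σ v then P σ else 0))
    ≡⟨ sumOver-swap (allFin n) (allSubsets n) _ ⟩
  sumOver (allSubsets n) (λ σ → sumOver (allFin n) (λ v → if lookup σ v then P σ else 0))
    ≡⟨ sumOver-cong (allSubsets n) (λ σ →
         trans (sum-members σ (P σ)) (size-on-cell X (suc i) σ (cobd β σ))) ⟩
  sumOver (allSubsets n) (λ σ → suc (suc i) * P σ)
    ≡⟨ sumOver-*ˡ (allSubsets n) (suc (suc i)) P ⟩
  suc (suc i) * sumOver (allSubsets n) P
    ≡⟨ cong (suc (suc i) *_) (sym (norm-as-sum X (suc i) (cobd β))) ⟩
  suc (suc i) * norm X (suc i) (cobd β) ∎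
  where
  open ≡-Reasoning
  P : Subset n → ℕ
  P σ = ⟦ isCell X (suc i) σ ∧ cobd β σ ⟧

superset-size : ∀ {n} (τ σ : Subset n) → τ ⊆ᵇ σ ≡ true → ∣ τ ∣ ℕ.≤ ∣ σ ∣
superset-size [] [] _ = z≤n
superset-size (false ∷ τ) (false ∷ σ) τ⊆σ = superset-size τ σ τ⊆σ
superset-size (false ∷ τ) (true ∷ σ) τ⊆σ = ℕₚ.m≤n⇒m≤1+n (superset-size τ σ τ⊆σ)
superset-size (true ∷ τ) (true ∷ σ) τ⊆σ = s≤s (superset-size τ σ τ⊆σ)

no-smaller-superset : ∀ {n} (τ σ : Subset n) (b : Bool) →
  ⟦ (b ∧ (suc ∣ σ ∣ ≡ᵇ ∣ τ ∣)) ∧ (τ ⊆ᵇ σ) ⟧ ≡ 0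
no-smaller-superset τ σ b with τ ⊆ᵇ σ in τ⊆σ | suc ∣ σ ∣ ≡ᵇ ∣ τ ∣ in size
... | false | _ = cong ⟦_⟧ (∧-zeroʳ _)
... | true | false = cong ⟦_⟧ (cong (_∧ true) (∧-zeroʳ b))
... | true | true = ⊥-elim (ℕₚ.<⇒≱ (ℕₚ.≤-reflexive (≡ᵇ-true (suc ∣ σ ∣) ∣ τ ∣ size)) (superset-size τ σ τ⊆σ))

-- The only superset of τ of the same size is τ itself.
equal-size-superset : ∀ {n} (τ : Subset n) (g : Subset n → Bool) →
  sumOver (allSubsets n) (λ σ → ⟦ (g σ ∧ (∣ σ ∣ ≡ᵇ ∣ τ ∣)) ∧ (τ ⊆ᵇ σ) ⟧) ≡ ⟦ g τ ⟧
equal-size-superset [] g rewrite ∧-identityʳ (g []) | ∧-identityʳ (g []) = ℕₚ.+-identityʳ ⟦ g [] ⟧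
equal-size-superset {suc n} (false ∷ τ) g =
  trans (sumOver-allSubsets-suc n _)
    (trans (cong₂ _+_ (equal-size-superset τ (g ∘ (false ∷_)))
                      (sumOver-vanishes (allSubsets n) (λ σ → no-smaller-superset τ σ (g (true ∷ σ)))))
           (ℕₚ.+-identityʳ _))
equal-size-superset {suc n} (true ∷ τ) g =
  trans (sumOver-allSubsets-suc n _)
    (cong₂ _+_ (sumOver-vanishes (allSubsets n) (λ σ → cong ⟦_⟧ (∧-zeroʳ _)))
               (equal-size-superset τ (g ∘ (true ∷_))))

linkCount : ∀ {n} → Faces n → Subset n → ℕ
linkCount {n} X τ = sumOver (allFin n) (λ v → ⟦ link X v τ ⟧)

-- The vertices v with τ ∈ X_v correspond to the faces of X one size up
-- containing τ.
link-count : ∀ {n} (X : Faces n) (τ : Subset n) →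
  linkCount X τ
    ≡ sumOver (allSubsets n) (λ σ → ⟦ (X σ ∧ (∣ σ ∣ ≡ᵇ suc ∣ τ ∣)) ∧ (τ ⊆ᵇ σ) ⟧)
link-count X [] rewrite ∧-zeroʳ (X []) = refl
link-count {suc n} X (false ∷ τ) = begin
  linkCount X (false ∷ τ)
    ≡⟨ sumOver-allFin-suc n (λ v → ⟦ link X v (false ∷ τ) ⟧) ⟩
  ⟦ X (true ∷ (τ ∪ ⊥)) ⟧ + linkCount X′ τ
    ≡⟨ ℕₚ.+-comm ⟦ X (true ∷ (τ ∪ ⊥)) ⟧ _ ⟩
  linkCount X′ τ + ⟦ X (true ∷ (τ ∪ ⊥)) ⟧
    ≡⟨ cong₂ _+_ (link-count X′ τ) (cong (λ s → ⟦ X (true ∷ s) ⟧) (∪-identityʳ τ)) ⟩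
  sumOver (allSubsets n) (λ σ → ⟦ (X′ σ ∧ (∣ σ ∣ ≡ᵇ suc ∣ τ ∣)) ∧ (τ ⊆ᵇ σ) ⟧) + ⟦ X (true ∷ τ) ⟧
    ≡⟨ cong (_+_ _) (sym (equal-size-superset τ (X ∘ (true ∷_)))) ⟩
  sumOver (allSubsets n) (λ σ → ⟦ (X′ σ ∧ (∣ σ ∣ ≡ᵇ suc ∣ τ ∣)) ∧ (τ ⊆ᵇ σ) ⟧)
    + sumOver (allSubsets n) (λ σ → ⟦ (X (true ∷ σ) ∧ (∣ σ ∣ ≡ᵇ ∣ τ ∣)) ∧ (τ ⊆ᵇ σ) ⟧)
    ≡⟨ sym (sumOver-allSubsets-suc n (λ σ → ⟦ (X σ ∧ (∣ σ ∣ ≡ᵇ suc ∣ τ ∣)) ∧ ((false ∷ τ) ⊆ᵇ σ) ⟧)) ⟩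
  sumOver (allSubsets (suc n)) (λ σ → ⟦ (X σ ∧ (∣ σ ∣ ≡ᵇ suc ∣ τ ∣)) ∧ ((false ∷ τ) ⊆ᵇ σ) ⟧) ∎
  where
  open ≡-Reasoning
  X′ : Faces n
  X′ = X ∘ (false ∷_)
link-count {suc n} X (true ∷ τ) =
  trans (sumOver-allFin-suc n (λ v → ⟦ link X v (true ∷ τ) ⟧))
    (trans (cong₂ _+_ (sym (sumOver-vanishes (allSubsets n) (λ σ → cong ⟦_⟧ (∧-zeroʳ _))))
                      (link-count (X ∘ (true ∷_)) τ))
           (sym (sumOver-allSubsets-suc n
              (λ σ → ⟦ (X σ ∧ (∣ σ ∣ ≡ᵇ suc ∣ true ∷ τ ∣)) ∧ ((true ∷ τ) ⊆ᵇ σ) ⟧))))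

-- Every i-cell of X lies in exactly m (i+1)-cells; TrianglesIn X m is the case i = 2.
CofacesIn : ∀ {n} → Faces n → ℕ → ℕ → Set
CofacesIn X i m = ∀ τ → X τ ≡ true → ∣ τ ∣ ≡ suc i →
  length (filterᵇ (τ ⊆ᵇ_) (cells X (suc i))) ≡ m

-- A non-face lies in no link, since X is closed under subsets.
linkCount-nonface : ∀ {n} {X : Faces n} → IsComplex X → ∀ τ → X τ ≡ false → linkCount X τ ≡ 0
linkCount-nonface {n} {X} cx τ τ∉X = sumOver-vanishes (allFin n) not-in-link
  where
  not-in-link : ∀ v → ⟦ link X v τ ⟧ ≡ 0
  not-in-link v with X (τ ∪ ⁅ v ⁆) in cone∈X
  ... | false = cong ⟦_⟧ (∧-zeroʳ _)
  ... | true with () ← trans (sym τ∉X) (IsComplex.downClosed cx τ (τ ∪ ⁅ v ⁆) (p⊆p∪q ⁅ v ⁆) cone∈X)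

linkCount-cell : ∀ {n} {X : Faces n} {i m} → CofacesIn X i m →
  ∀ τ → X τ ≡ true → ∣ τ ∣ ≡ suc i → linkCount X τ ≡ m
linkCount-cell {n} {X} {i} regular τ τ∈X size = begin
  linkCount X τ
    ≡⟨ link-count X τ ⟩
  sumOver (allSubsets n) (λ σ → ⟦ (X σ ∧ (∣ σ ∣ ≡ᵇ suc ∣ τ ∣)) ∧ (τ ⊆ᵇ σ) ⟧)
    ≡⟨ cong (λ k → sumOver (allSubsets n) (λ σ → ⟦ (X σ ∧ (∣ σ ∣ ≡ᵇ suc k)) ∧ (τ ⊆ᵇ σ) ⟧)) size ⟩
  sumOver (allSubsets n) (λ σ → ⟦ isCell X (suc i) σ ∧ (τ ⊆ᵇ σ) ⟧)
    ≡⟨ sym (norm-as-sum X (suc i) (τ ⊆ᵇ_)) ⟩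
  norm X (suc i) (τ ⊆ᵇ_)
    ≡⟨ regular τ τ∈X size ⟩
  _ ∎
  where open ≡-Reasoning

link-weight : ∀ {n} {X : Faces n} {i m} → IsComplex X → CofacesIn X i m →
  ∀ τ a → linkCount X τ * ⟦ (∣ τ ∣ ≡ᵇ suc i) ∧ a ⟧ ≡ m * ⟦ isCell X i τ ∧ a ⟧
link-weight {X = X} {i} {m} cx regular τ a with X τ in τ∈X | ∣ τ ∣ ≡ᵇ suc i in size
... | false | _ = trans (cong (_* _) (linkCount-nonface cx τ τ∈X)) (sym (ℕₚ.*-zeroʳ m))
... | true | false = trans (ℕₚ.*-zeroʳ (linkCount X τ)) (sym (ℕₚ.*-zeroʳ m))
... | true | true = cong (_* ⟦ a ⟧) (linkCount-cell regular τ τ∈X (≡ᵇ-true ∣ τ ∣ (suc i) size))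

sumV-link-norm : ∀ {n} {X : Faces n} {i m} → IsComplex X → CofacesIn X i m →
  ∀ (α : Cochain n) → sumV (λ v → norm (link X v) i α) ≡ m * norm X i α
sumV-link-norm {n} {X} {i} {m} cx regular α = begin
  sumV (λ v → norm (link X v) i α)
    ≡⟨ sumOver-cong (allFin n) (λ v → norm-as-sum (link X v) i α) ⟩
  sumOver (allFin n) (λ v → sumOver (allSubsets n) (λ τ → ⟦ isCell (link X v) i τ ∧ α τ ⟧))
    ≡⟨ sumOver-swap (allFin n) (allSubsets n) _ ⟩
  sumOver (allSubsets n) (λ τ → sumOver (allFin n) (λ v → ⟦ isCell (link X v) i τ ∧ α τ ⟧))
    ≡⟨ sumOver-cong (allSubsets n) (λ τ → factor-link τ) ⟩
  sumOver (allSubsets n) (λ τ → linkCount X τ * ⟦ (∣ τ ∣ ≡ᵇ suc i) ∧ α τ ⟧)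
    ≡⟨ sumOver-cong (allSubsets n) (λ τ → link-weight cx regular τ (α τ)) ⟩
  sumOver (allSubsets n) (λ τ → m * ⟦ isCell X i τ ∧ α τ ⟧)
    ≡⟨ sumOver-*ˡ (allSubsets n) m _ ⟩
  m * sumOver (allSubsets n) (λ τ → ⟦ isCell X i τ ∧ α τ ⟧)
    ≡⟨ cong (m *_) (sym (norm-as-sum X i α)) ⟩
  m * norm X i α ∎
  where
  open ≡-Reasoning
  factor-link : ∀ τ → sumOver (allFin n) (λ v → ⟦ isCell (link X v) i τ ∧ α τ ⟧)
                      ≡ linkCount X τ * ⟦ (∣ τ ∣ ≡ᵇ suc i) ∧ α τ ⟧
  factor-link τ = trans
    (sumOver-cong (allFin n) (λ v → ⟦∧⟧-factor (link X v τ) (∣ τ ∣ ≡ᵇ suc i) (α τ)))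
    (sumOver-*ʳ (allFin n) _ (λ v → ⟦ link X v τ ⟧))

proposition7p13 : (q : ℕ) → IsPrimePower q → (n : ℕ) → (X : Faces n) →
  IsComplex X → Dim≤3 X → TrianglesIn X (suc q) →
  (β : Cochain n) →
    (4 * norm X 3 (cobd β)
      ≡ sumV (λ v → norm (link X v) 2 (cobd (beta1 β v) ⊕ beta2 β v)))
    × ((+ sumV (λ v → norm (link X v) 2 (cobd (beta1 β v))))
        - (+ sumV (λ v → norm (link X v) 2 (beta2 β v)))
        ≤ + sumV (λ v → norm (link X v) 2 (cobd (beta1 β v) ⊕ beta2 β v)))
    × (sumV (λ v → norm (link X v) 2 (beta2 β v)) ≡ suc q * norm X 2 β)
proposition7p13 q _ n X complex _ triangles β =
    sym (sumV-link-norm-cobd X 2 β)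
  , sumV-norm-triangle (link X) 2 (λ v → cobd (beta1 β v)) (beta2 β)
  , sumV-link-norm complex triangles β
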